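{- Let $F\colon\mathbb{F}_2^6\to\mathbb{F}_2^6$ be an APN function of algebraic degree $6$. Then for every $u\in\mathbb{F}_2^6\setminus\{0\}$ the counting function $n_u$ has algebraic degree $5$.
   Context: $F\colon\mathbb{F}_2^m\to\mathbb{F}_2^m$ is APN if for every $u\ne 0$ and every $v$, the number $N_F(u,v)$ of $x$ with $F(x+u)+F(x)=v$ is at most $2$ (hence in $\{0,2\}$). For APN $F$ and $u\ne0$, the counting function $n_u\colon\mathbb{F}_2^m\to\mathbb{F}_2$ is $n_u(v)=1$ if $N_F(u,v)=2$ and $n_u(v)=0$ if $N_F(u,v)=0$. The algebraic degree of a Boolean function is the degree of its reduced algebraic normal form; the algebraic degree of a vectorial function is the maximum algebraic degree of its components $x\mapsto b\cdot F(x)$. -}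

module Defs where

open import Data.Bool using (Bool; true; false; _∧_; _∨_; not; _xor_)
open import Data.Bool.Properties using () renaming (_≟_ to _≟B_)
open import Data.Nat using (ℕ; zero; suc; _+_; _⊔_; _≤_)
open import Data.Nat.Properties using () renaming (_≟_ to _≟ℕ_)
open import Data.Vec using (Vec; []; _∷_; zipWith; replicate)
open import Data.Vec.Properties using (≡-dec)
open import Data.List using (List; []; _∷_; map; _++_; foldr; length; filter)
open import Data.Product using (Σ; ∃; _×_; _,_)
open import Relation.Binary.PropositionalEquality using (_≡_)
open import Relation.Nullary using (¬_; does)

-- 𝔽₂ = Bool (addition = xor, multiplication = ∧); 𝔽₂^m = Vec Bool m
F2^ : ℕ → Set
F2^ m = Vec Bool m

_⊕_ : ∀ {m} → F2^ m → F2^ m → F2^ m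
_⊕_ = zipWith _xor_

zeroV : ∀ {m} → F2^ m
zeroV = replicate _ false

allVecs : ∀ m → List (F2^ m)
allVecs zero = [] ∷ []
allVecs (suc m) = map (false ∷_) (allVecs m) ++ map (true ∷_) (allVecs m)

xorSum : List Bool → Bool
xorSum = foldr _xor_ false

_·_ : ∀ {m} → F2^ m → F2^ m → Bool
[] · [] = false
(b ∷ bs) · (y ∷ ys) = (b ∧ y) xor (bs · ys)

wt : ∀ {m} → F2^ m → ℕ
wt [] = 0
wt (true ∷ s) = suc (wt s)
wt (false ∷ s) = wt s

-- monomial x^S = ∏_{i ∈ S} x_i
monomial : ∀ {m} → F2^ m → F2^ m → Bool
monomial [] [] = true
monomial (s ∷ ss) (x ∷ xs) = (not s ∨ x) ∧ monomial ss xs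

BoolFun : ℕ → Set
BoolFun m = F2^ m → Bool

VecFun : ℕ → Set
VecFun m = F2^ m → F2^ m

-- an ANF is a coefficient function a : subsets S (as indicator vectors) → 𝔽₂;
-- a represents f if f(x) = Σ_S a_S x^S for all x
Represents : ∀ {m} → (F2^ m → Bool) → BoolFun m → Set
Represents {m} a f = ∀ x → f x ≡ xorSum (map (λ S → a S ∧ monomial S x) (allVecs m))

anfDeg : ∀ {m} → (F2^ m → Bool) → ℕ
anfDeg {m} a = foldr _⊔_ 0 (map (λ S → if′ (a S) (wt S)) (allVecs m))
  where
  if′ : Bool → ℕ → ℕ
  if′ true n = n
  if′ false _ = 0

-- f has algebraic degree d: its (reduced, i.e. unique) ANF has degree d
HasAlgDeg : ∀ {m} → BoolFun m → ℕ → Set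
HasAlgDeg {m} f d = Σ (F2^ m → Bool) λ a → Represents a f × anfDeg a ≡ d

component : ∀ {m} → F2^ m → VecFun m → BoolFun m
component b F x = b · F x

HasAlgDegV : ∀ {m} → VecFun m → ℕ → Set
HasAlgDegV {m} F d =
  (∀ (b : F2^ m) (d' : ℕ) → HasAlgDeg (component b F) d' → d' ≤ d)
  × Σ (F2^ m) (λ b → HasAlgDeg (component b F) d)

N : ∀ {m} → VecFun m → F2^ m → F2^ m → ℕ
N {m} F u v = length (filter (λ x → ≡-dec _≟B_ (F (x ⊕ u) ⊕ F x) v) (allVecs m))

IsAPN : ∀ {m} → VecFun m → Set
IsAPN {m} F = ∀ (u v : F2^ m) → ¬ (u ≡ zeroV) → N F u v ≤ 2

-- counting function n_u(v) = 1 iff N_F(u,v) = 2 (else N_F(u,v) = 0 for APN F)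
countingFun : ∀ {m} → VecFun m → F2^ m → BoolFun m
countingFun F u v = does (N F u v ≟ℕ 2)

{-# OPTIONS --safe #-}

-- For APN F and u ≠ 0 every N_F(u, v) is 0 or 2, so Σ_x h(F(x ⊕ u) ⊕ F x) = 2 Σ_v n_u(v) h(v) for all h.
-- With h = 1 this makes the weight of n_u equal to 2^(m-1), which is even for m ≥ 2, so the top ANF coefficient
-- ⨁_v n_u(v) of n_u vanishes. With h(v) = b · v for a component b · F of degree m, the left side is
-- 2k where k, the number of cosets {x, x ⊕ u} on which b · F is not constant, has the parity of
-- ⨁_x b · F(x) = 1. Hence ⨁_v n_u(v) (b · v) = 1; expanding n_u into monomials x^S, and using that
-- ⨁_v x^S(v) (b · v) = 0 whenever wt S ≤ m - 2, some x^S with wt S = m - 1 occurs in n_u.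
module Submission where

open import Defs
open import Algebra.Bundles using (CommutativeRing; CommutativeSemigroup)
open import Algebra.Core using (Op₂)
open import Algebra.Structures using (IsCommutativeMonoid)
import Algebra.Properties.CommutativeSemigroup as CommutativeSemigroupProperties
open import Data.Bool using (Bool; true; false; _∧_; not; _xor_; if_then_else_)
open import Data.Bool.Properties
  using (xor-∧-commutativeRing; xor-assoc; xor-comm; xor-same; xor-identityʳ; xor-inverseʳ;
         not-distribˡ-xor; not-distribʳ-xor; ∧-zeroʳ; ∧-identityʳ; ∧-assoc; ∧-distribˡ-xor; ∧-distribʳ-xor)
  renaming (_≟_ to _≟B_)
open import Data.List using (List; []; _∷_; map; _++_; foldr; length; filter)
open import Data.List.Properties using (map-cong; map-∘; foldr-preservesᵇ; foldr-preservesᵒ)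
open import Data.List.Membership.Propositional using (_∈_)
open import Data.List.Membership.Propositional.Properties
  using (∈-map⁺; ∈-map⁻; ∈-++⁺ˡ; ∈-++⁺ʳ; foldr-selective)
open import Data.List.Relation.Unary.All using (universal)
open import Data.List.Relation.Unary.All.Properties using () renaming (map⁺ to All-map⁺)
open import Data.List.Relation.Unary.Any using (here) renaming (map to Any-map)
open import Data.Nat using (ℕ; zero; suc; _+_; _*_; _^_; _⊔_; _≤_; _<_; _≤?_; z≤n; s≤s; s≤s⁻¹)
open import Data.Nat.Properties
  using (+-0-isCommutativeMonoid; suc-injective; +-identityʳ; *-distribˡ-+; *-distribʳ-+; *-zeroʳ; *-assoc;
         *-cancelˡ-≡; ≤-reflexive; ≤-antisym; ≤-trans; ≤-pred; ≤∧≢⇒<; ≰⇒>; m≤n⇒m≤1+n; 1+n≰n; n≤0⇒n≡0; m+1+n≢0;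
         ⊔-lub; ⊔-sel; m≤n⇒m≤n⊔o; m≤n⇒m≤o⊔n)
  renaming (_≟_ to _≟ℕ_)
open import Data.Product using (∃; _×_; _,_; proj₁; proj₂)
open import Data.Sum using (inj₁; inj₂; [_,_])
open import Data.Vec using ([]; _∷_; replicate)
open import Data.Vec.Properties using (≡-dec)
open import Function using (_∘_)
open import Level using (0ℓ)
open import Relation.Binary.Definitions using (DecidableEquality)
open import Relation.Binary.PropositionalEquality
  using (_≡_; _≢_; refl; sym; trans; cong; cong₂; subst; module ≡-Reasoning)
open import Relation.Nullary using (¬_; does; yes; no; contradiction)
open import Relation.Unary using (Decidable)

foldr-map-homo : ∀ {A B C : Set} {_∙_ : Op₂ A} {ε : A} {_◦_ : Op₂ B} {ε′ : B} (φ : A → B) →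
  φ ε ≡ ε′ → (∀ x y → φ (x ∙ y) ≡ φ x ◦ φ y) →
  (g : C → A) (xs : List C) → φ (foldr _∙_ ε (map g xs)) ≡ foldr _◦_ ε′ (map (φ ∘ g) xs)
foldr-map-homo φ φ-ε φ-∙ g [] = φ-ε
foldr-map-homo {_◦_ = _◦_} φ φ-ε φ-∙ g (x ∷ xs) =
  trans (φ-∙ _ _) (cong (φ (g x) ◦_) (foldr-map-homo φ φ-ε φ-∙ g xs))

ones : ∀ {m} → F2^ m
ones = replicate _ true

_≟ᵥ_ : ∀ {m} → DecidableEquality (F2^ m)
_≟ᵥ_ = ≡-dec _≟B_

∈-allVecs : ∀ {m} (x : F2^ m) → x ∈ allVecs m
∈-allVecs [] = here refl
∈-allVecs {suc m} (false ∷ x) = ∈-++⁺ˡ (∈-map⁺ (false ∷_) (∈-allVecs x))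
∈-allVecs {suc m} (true ∷ x) = ∈-++⁺ʳ (map (false ∷_) (allVecs m)) (∈-map⁺ (true ∷_) (∈-allVecs x))

⊕-comm : ∀ {m} (x y : F2^ m) → x ⊕ y ≡ y ⊕ x
⊕-comm [] [] = refl
⊕-comm (x₀ ∷ x) (y₀ ∷ y) = cong₂ _∷_ (xor-comm x₀ y₀) (⊕-comm x y)

⊕-cancelʳ : ∀ {m} (x u : F2^ m) → (x ⊕ u) ⊕ u ≡ x
⊕-cancelʳ [] [] = refl
⊕-cancelʳ (x₀ ∷ x) (u₀ ∷ u) =
  cong₂ _∷_ (trans (xor-assoc x₀ u₀ u₀) (trans (cong (x₀ xor_) (xor-same u₀)) (xor-identityʳ x₀)))
            (⊕-cancelʳ x u)

wt≤ : ∀ {m} (S : F2^ m) → wt S ≤ m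
wt≤ [] = z≤n
wt≤ (true ∷ S) = s≤s (wt≤ S)
wt≤ (false ∷ S) = m≤n⇒m≤1+n (wt≤ S)

wt≡⇒≡ones : ∀ {m} (S : F2^ m) → wt S ≡ m → S ≡ ones
wt≡⇒≡ones [] _ = refl
wt≡⇒≡ones (true ∷ S) eq = cong (true ∷_) (wt≡⇒≡ones S (suc-injective eq))
wt≡⇒≡ones {suc m} (false ∷ S) eq = contradiction (subst (_≤ m) eq (wt≤ S)) 1+n≰n

monomial-ones : ∀ {m} (S : F2^ m) → wt S < m → monomial ones S ≡ false
monomial-ones (false ∷ S) _ = refl
monomial-ones (true ∷ S) (s≤s lt) = monomial-ones S lt

-- For u ≠ 0, one point of each coset {x, x ⊕ u}.
transversal : ∀ {m} → F2^ m → List (F2^ m)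
transversal {zero} [] = []
transversal {suc m} (true ∷ u) = map (false ∷_) (allVecs m)
transversal {suc m} (false ∷ u) = map (false ∷_) (transversal u) ++ map (true ∷_) (transversal u)

-- Sums over 𝔽₂^m

module Sums {A : Set} {_∙_ : Op₂ A} {ε : A} (isCM : IsCommutativeMonoid _≡_ _∙_ ε) where
  open IsCommutativeMonoid isCM using (assoc; comm; identityˡ; isCommutativeSemigroup)

  private
    commutativeSemigroup : CommutativeSemigroup 0ℓ 0ℓ
    commutativeSemigroup = record { isCommutativeSemigroup = isCommutativeSemigroup }

  open CommutativeSemigroupProperties commutativeSemigroup public using (interchange)
  open ≡-Reasoning

  sumOver : ∀ {B : Set} → (B → A) → List B → A
  sumOver g xs = foldr _∙_ ε (map g xs)

  sumOver-++ : ∀ {B : Set} (g : B → A) xs ys → sumOver g (xs ++ ys) ≡ sumOver g xs ∙ sumOver g ys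
  sumOver-++ g [] ys = sym (identityˡ _)
  sumOver-++ g (x ∷ xs) ys = trans (cong (g x ∙_) (sumOver-++ g xs ys)) (sym (assoc _ _ _))

  sumOver-map : ∀ {B C : Set} (g : C → A) (h : B → C) xs → sumOver g (map h xs) ≡ sumOver (g ∘ h) xs
  sumOver-map g h xs = cong (foldr _∙_ ε) (sym (map-∘ xs))

  sumOver-cong : ∀ {B : Set} {g h : B → A} → (∀ x → g x ≡ h x) → ∀ xs → sumOver g xs ≡ sumOver h xs
  sumOver-cong g≗h xs = cong (foldr _∙_ ε) (map-cong g≗h xs)

  sumOver-∙ : ∀ {B : Set} (g h : B → A) xs → sumOver (λ x → g x ∙ h x) xs ≡ sumOver g xs ∙ sumOver h xs
  sumOver-∙ g h [] = sym (identityˡ ε)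
  sumOver-∙ g h (x ∷ xs) = trans (cong ((g x ∙ h x) ∙_) (sumOver-∙ g h xs)) (interchange _ _ _ _)

  sumOver-ε : ∀ {B : Set} (xs : List B) → sumOver (λ _ → ε) xs ≡ ε
  sumOver-ε [] = refl
  sumOver-ε (x ∷ xs) = trans (identityˡ _) (sumOver-ε xs)

  sumOver-swap : ∀ {B C : Set} (h : B → C → A) xs ys →
    sumOver (λ x → sumOver (h x) ys) xs ≡ sumOver (λ y → sumOver (λ x → h x y) xs) ys
  sumOver-swap h [] ys = sym (sumOver-ε ys)
  sumOver-swap h (x ∷ xs) ys =
    trans (cong (sumOver (h x) ys ∙_) (sumOver-swap h xs ys)) (sym (sumOver-∙ (h x) _ ys))

  ∑ : ∀ {m} → (F2^ m → A) → A
  ∑ {m} g = sumOver g (allVecs m)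

  ∑-split : ∀ {m} (g : F2^ (suc m) → A) → ∑ g ≡ ∑ (g ∘ (false ∷_)) ∙ ∑ (g ∘ (true ∷_))
  ∑-split {m} g = trans (sumOver-++ g (map (false ∷_) (allVecs m)) _)
    (cong₂ _∙_ (sumOver-map g _ (allVecs m)) (sumOver-map g _ (allVecs m)))

  ∑-cong : ∀ {m} {g h : F2^ m → A} → (∀ x → g x ≡ h x) → ∑ g ≡ ∑ h
  ∑-cong {m} g≗h = sumOver-cong g≗h (allVecs m)

  ∑-∙ : ∀ {m} (g h : F2^ m → A) → ∑ (λ x → g x ∙ h x) ≡ ∑ g ∙ ∑ h
  ∑-∙ {m} g h = sumOver-∙ g h (allVecs m)

  ∑-ε : ∀ {m} → ∑ {m} (λ _ → ε) ≡ ε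
  ∑-ε {m} = sumOver-ε (allVecs m)

  ∑-swap : ∀ {m} (h : F2^ m → F2^ m → A) → ∑ (λ x → ∑ (h x)) ≡ ∑ (λ y → ∑ (λ x → h x y))
  ∑-swap {m} h = sumOver-swap h (allVecs m) (allVecs m)

  ∑-translate : ∀ {m} (g : F2^ m → A) (w : F2^ m) → ∑ (λ y → g (y ⊕ w)) ≡ ∑ g
  ∑-translate {zero} g [] = refl
  ∑-translate {suc m} g (w₀ ∷ w) = begin
    ∑ (λ y → g (y ⊕ (w₀ ∷ w)))
      ≡⟨ ∑-split (λ y → g (y ⊕ (w₀ ∷ w))) ⟩
    ∑ (λ y → g (w₀ ∷ (y ⊕ w))) ∙ ∑ (λ y → g (not w₀ ∷ (y ⊕ w)))
      ≡⟨ cong₂ _∙_ (∑-translate (g ∘ (w₀ ∷_)) w) (∑-translate (g ∘ (not w₀ ∷_)) w) ⟩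
    ∑ (g ∘ (w₀ ∷_)) ∙ ∑ (g ∘ (not w₀ ∷_))
      ≡⟨ halves w₀ ⟩
    ∑ g ∎
    where
    halves : ∀ c → ∑ (g ∘ (c ∷_)) ∙ ∑ (g ∘ (not c ∷_)) ≡ ∑ g
    halves false = sym (∑-split g)
    halves true = trans (comm _ _) (sym (∑-split g))

  ∑-transversal : ∀ {m} {u : F2^ m} → u ≢ zeroV → (g : F2^ m → A) →
    ∑ g ≡ sumOver (λ x → g x ∙ g (x ⊕ u)) (transversal u)
  ∑-transversal {zero} {[]} u≢0 g = contradiction refl u≢0
  ∑-transversal {suc m} {true ∷ u} _ g = begin
    ∑ g
      ≡⟨ ∑-split g ⟩
    ∑ (g ∘ (false ∷_)) ∙ ∑ (g ∘ (true ∷_))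
      ≡⟨ cong (∑ (g ∘ (false ∷_)) ∙_) (sym (∑-translate (g ∘ (true ∷_)) u)) ⟩
    ∑ (g ∘ (false ∷_)) ∙ ∑ (λ y → g (true ∷ (y ⊕ u)))
      ≡⟨ sym (∑-∙ (g ∘ (false ∷_)) (λ y → g (true ∷ (y ⊕ u)))) ⟩
    ∑ (λ y → g (false ∷ y) ∙ g (true ∷ (y ⊕ u)))
      ≡⟨ sym (sumOver-map (λ x → g x ∙ g (x ⊕ (true ∷ u))) (false ∷_) (allVecs m)) ⟩
    sumOver (λ x → g x ∙ g (x ⊕ (true ∷ u))) (map (false ∷_) (allVecs m)) ∎
  ∑-transversal {suc m} {false ∷ u} u≢0 g = begin
    ∑ g
      ≡⟨ ∑-split g ⟩
    ∑ (g ∘ (false ∷_)) ∙ ∑ (g ∘ (true ∷_))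
      ≡⟨ cong₂ _∙_ (∑-transversal u′≢0 (g ∘ (false ∷_))) (∑-transversal u′≢0 (g ∘ (true ∷_))) ⟩
    sumOver (h ∘ (false ∷_)) T ∙ sumOver (h ∘ (true ∷_)) T
      ≡⟨ sym (cong₂ _∙_ (sumOver-map h (false ∷_) T) (sumOver-map h (true ∷_) T)) ⟩
    sumOver h (map (false ∷_) T) ∙ sumOver h (map (true ∷_) T)
      ≡⟨ sym (sumOver-++ h (map (false ∷_) T) (map (true ∷_) T)) ⟩
    sumOver h (transversal (false ∷ u)) ∎
    where
    T : List (F2^ m)
    T = transversal u
    h : F2^ (suc m) → A
    h x = g x ∙ g (x ⊕ (false ∷ u))
    u′≢0 : u ≢ zeroV
    u′≢0 = u≢0 ∘ cong (false ∷_)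

module ⨁ = Sums (CommutativeRing.+-isCommutativeMonoid xor-∧-commutativeRing)
module ∑ = Sums +-0-isCommutativeMonoid

open ⨁ using () renaming (∑ to ⨁)
open ∑ using (∑)

∧-distribˡ-⨁ : ∀ {m} c (g : F2^ m → Bool) → c ∧ ⨁ g ≡ ⨁ (λ x → c ∧ g x)
∧-distribˡ-⨁ {m} c g = foldr-map-homo (c ∧_) (∧-zeroʳ c) (∧-distribˡ-xor c) g (allVecs m)

∧-distribʳ-⨁ : ∀ {m} c (g : F2^ m → Bool) → ⨁ g ∧ c ≡ ⨁ (λ x → g x ∧ c)
∧-distribʳ-⨁ {m} c g = foldr-map-homo (_∧ c) refl (λ x y → ∧-distribʳ-xor c x y) g (allVecs m)

*-distribʳ-∑ : ∀ {m} c (g : F2^ m → ℕ) → ∑ g * c ≡ ∑ (λ x → g x * c)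
*-distribʳ-∑ {m} c g = foldr-map-homo (_* c) refl (λ x y → *-distribʳ-+ c x y) g (allVecs m)

*-distribˡ-∑ : ∀ {m} c (g : F2^ m → ℕ) → c * ∑ g ≡ ∑ (λ x → c * g x)
*-distribˡ-∑ {m} c g = foldr-map-homo (c *_) (*-zeroʳ c) (*-distribˡ-+ c) g (allVecs m)

·-distribˡ-⊕ : ∀ {m} (b y z : F2^ m) → b · (y ⊕ z) ≡ (b · y) xor (b · z)
·-distribˡ-⊕ [] [] [] = refl
·-distribˡ-⊕ (b₀ ∷ b) (y₀ ∷ y) (z₀ ∷ z) =
  trans (cong₂ _xor_ (∧-distribˡ-xor b₀ y₀ z₀) (·-distribˡ-⊕ b y z))
        (⨁.interchange (b₀ ∧ y₀) (b₀ ∧ z₀) (b · y) (b · z))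

⨁-∧≡true⇒∃ : ∀ {B : Set} (p q : B → Bool) xs →
  ⨁.sumOver (λ x → p x ∧ q x) xs ≡ true → ∃ λ x → p x ≡ true × q x ≡ true
⨁-∧≡true⇒∃ p q (x ∷ xs) sum≡true with p x in px | q x in qx
... | true | true = x , px , qx
... | true | false = ⨁-∧≡true⇒∃ p q xs sum≡true
... | false | _ = ⨁-∧≡true⇒∃ p q xs sum≡true

⟦_⟧ : Bool → ℕ
⟦ true ⟧ = 1
⟦ false ⟧ = 0

⟦⟧-∧ : ∀ x y → ⟦ x ∧ y ⟧ ≡ ⟦ x ⟧ * ⟦ y ⟧
⟦⟧-∧ true y = sym (+-identityʳ ⟦ y ⟧)
⟦⟧-∧ false y = refl

odd : ℕ → Bool
odd zero = false
odd (suc n) = not (odd n)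

odd-+ : ∀ m n → odd (m + n) ≡ odd m xor odd n
odd-+ zero n = refl
odd-+ (suc m) n = trans (cong not (odd-+ m n)) (not-distribˡ-xor (odd m) (odd n))

odd-2* : ∀ n → odd (2 * n) ≡ false
odd-2* n = trans (odd-+ n (n + 0)) (trans (cong (odd n xor_) (cong odd (+-identityʳ n))) (xor-same (odd n)))

odd-sumOver : ∀ {B : Set} (p : B → Bool) xs → odd (∑.sumOver (⟦_⟧ ∘ p) xs) ≡ ⨁.sumOver p xs
odd-sumOver p xs = trans (foldr-map-homo odd refl odd-+ (⟦_⟧ ∘ p) xs) (⨁.sumOver-cong (odd-⟦⟧ ∘ p) xs)
  where
  odd-⟦⟧ : ∀ b → odd ⟦ b ⟧ ≡ b
  odd-⟦⟧ true = refl
  odd-⟦⟧ false = refl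

odd-∑ : ∀ {m} (p : F2^ m → Bool) → odd (∑ (⟦_⟧ ∘ p)) ≡ ⨁ p
odd-∑ {m} p = odd-sumOver p (allVecs m)

∑-one : ∀ {m} → ∑ {m} (λ _ → 1) ≡ 2 ^ m
∑-one {zero} = refl
∑-one {suc m} = begin
  ∑ {suc m} (λ _ → 1)               ≡⟨ ∑.∑-split {m} (λ _ → 1) ⟩
  ∑ {m} (λ _ → 1) + ∑ {m} (λ _ → 1) ≡⟨ cong₂ _+_ (∑-one {m}) (∑-one {m}) ⟩
  2 ^ m + 2 ^ m                     ≡⟨ cong (2 ^ m +_) (sym (+-identityʳ (2 ^ m))) ⟩
  2 ^ suc m                         ∎
  where open ≡-Reasoning

length-filter : ∀ {B : Set} {P : B → Set} (P? : Decidable P) xs →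
  length (filter P? xs) ≡ ∑.sumOver (λ x → ⟦ does (P? x) ⟧) xs
length-filter P? [] = refl
length-filter P? (x ∷ xs) with does (P? x)
... | true = cong suc (length-filter P? xs)
... | false = length-filter P? xs

∑-invariant : ∀ {m} {u : F2^ m} → u ≢ zeroV → (g : F2^ m → ℕ) → (∀ x → g (x ⊕ u) ≡ g x) →
  ∑ g ≡ 2 * ∑.sumOver g (transversal u)
∑-invariant {u = u} u≢0 g invariant = begin
  ∑ g                                 ≡⟨ ∑.∑-transversal u≢0 g ⟩
  ∑.sumOver (λ x → g x + g (x ⊕ u)) T ≡⟨ ∑.sumOver-cong (λ x → cong (g x +_) (invariant x)) T ⟩
  ∑.sumOver (λ x → g x + g x) T       ≡⟨ ∑.sumOver-∙ g g T ⟩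
  k + k                               ≡⟨ cong (k +_) (sym (+-identityʳ k)) ⟩
  2 * k                               ∎
  where
  open ≡-Reasoning
  T : List (F2^ _)
  T = transversal u
  k : ℕ
  k = ∑.sumOver g T

∑-derivative : ∀ {m} {u : F2^ m} → u ≢ zeroV → (f : BoolFun m) →
  ∃ λ k → ∑ (λ x → ⟦ f (x ⊕ u) xor f x ⟧) ≡ 2 * k × odd k ≡ ⨁ f
∑-derivative {u = u} u≢0 f = ∑.sumOver g T , ∑-invariant u≢0 g g-invariant , (begin
  odd (∑.sumOver g T)                        ≡⟨ odd-sumOver (λ x → f (x ⊕ u) xor f x) T ⟩
  ⨁.sumOver (λ x → f (x ⊕ u) xor f x) T    ≡⟨ ⨁.sumOver-cong (λ x → xor-comm (f (x ⊕ u)) (f x)) T ⟩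
  ⨁.sumOver (λ x → f x xor f (x ⊕ u)) T    ≡⟨ sym (⨁.∑-transversal u≢0 f) ⟩
  ⨁ f                                        ∎)
  where
  open ≡-Reasoning
  T : List (F2^ _)
  T = transversal u
  g : F2^ _ → ℕ
  g x = ⟦ f (x ⊕ u) xor f x ⟧
  g-invariant : ∀ x → g (x ⊕ u) ≡ g x
  g-invariant x = cong ⟦_⟧ (trans (cong (λ y → f y xor f (x ⊕ u)) (⊕-cancelʳ x u)) (xor-comm (f x) _))

-- Algebraic normal forms and their degree

anf : ∀ {m} → BoolFun m → F2^ m → Bool
anf {zero} f [] = f []
anf {suc m} f (false ∷ S) = anf (λ y → f (false ∷ y)) S
anf {suc m} f (true ∷ S) = anf (λ y → f (false ∷ y) xor f (true ∷ y)) S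

anf-represents : ∀ {m} (f : BoolFun m) → Represents (anf f) f
anf-represents {zero} f [] = sym (trans (xor-identityʳ _) (∧-identityʳ (f [])))
anf-represents {suc m} f (x₀ ∷ x) = begin
  f (x₀ ∷ x)
    ≡⟨ expand x₀ ⟩
  f₀ x xor (x₀ ∧ f₁ x)
    ≡⟨ cong₂ _xor_ (anf-represents f₀ x) (cong (x₀ ∧_) (anf-represents f₁ x)) ⟩
  A₀ xor (x₀ ∧ ⨁ (λ S → anf f₁ S ∧ monomial S x))
    ≡⟨ cong (A₀ xor_) (∧-distribˡ-⨁ x₀ (λ S → anf f₁ S ∧ monomial S x)) ⟩
  A₀ xor ⨁ (λ S → x₀ ∧ (anf f₁ S ∧ monomial S x))
    ≡⟨ cong (A₀ xor_) (⨁.∑-cong (λ S → reorder x₀ (anf f₁ S) (monomial S x))) ⟩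
  A₀ xor ⨁ (λ S → anf f₁ S ∧ (x₀ ∧ monomial S x))
    ≡⟨ sym (⨁.∑-split (λ S → anf f S ∧ monomial S (x₀ ∷ x))) ⟩
  ⨁ (λ S → anf f S ∧ monomial S (x₀ ∷ x)) ∎
  where
  open ≡-Reasoning
  f₀ f₁ : BoolFun m
  f₀ y = f (false ∷ y)
  f₁ y = f (false ∷ y) xor f (true ∷ y)
  expand : ∀ x₀ → f (x₀ ∷ x) ≡ f₀ x xor (x₀ ∧ f₁ x)
  expand false = sym (xor-identityʳ (f₀ x))
  expand true = sym (trans (sym (xor-assoc (f₀ x) (f₀ x) _)) (cong (_xor f (true ∷ x)) (xor-same (f₀ x))))
  A₀ : Bool
  A₀ = ⨁ (λ S → anf f₀ S ∧ monomial S x)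
  reorder : ∀ c p q → c ∧ (p ∧ q) ≡ p ∧ (c ∧ q)
  reorder true p q = refl
  reorder false p q = sym (∧-zeroʳ p)

-- monomial ones S is the indicator of S ≡ ones.
⨁-monomial : ∀ {m} (S : F2^ m) → ⨁ (monomial S) ≡ monomial ones S
⨁-monomial [] = refl
⨁-monomial {suc m} (false ∷ S) = trans (⨁.∑-split (monomial (false ∷ S))) (xor-same (⨁ (monomial S)))
⨁-monomial {suc m} (true ∷ S) =
  trans (⨁.∑-split (monomial (true ∷ S))) (trans (cong (_xor ⨁ (monomial S)) (⨁.∑-ε {m})) (⨁-monomial S))

⨁-select-ones : ∀ {m} (a : F2^ m → Bool) → ⨁ (λ S → a S ∧ monomial ones S) ≡ a ones
⨁-select-ones {zero} a = trans (xor-identityʳ _) (∧-identityʳ (a []))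
⨁-select-ones {suc m} a = trans (⨁.∑-split (λ S → a S ∧ monomial ones S))
  (cong₂ _xor_ (trans (⨁.∑-cong (λ S → ∧-zeroʳ (a (false ∷ S)))) (⨁.∑-ε {m}))
               (⨁-select-ones (a ∘ (true ∷_))))

⨁-∧-represented : ∀ {m} {a : F2^ m → Bool} {f : BoolFun m} → Represents a f → (g : BoolFun m) →
  ⨁ (λ v → f v ∧ g v) ≡ ⨁ (λ S → a S ∧ ⨁ (λ v → monomial S v ∧ g v))
⨁-∧-represented {a = a} {f} represents g = begin
  ⨁ (λ v → f v ∧ g v)
    ≡⟨ ⨁.∑-cong (λ v → cong (_∧ g v) (represents v)) ⟩
  ⨁ (λ v → ⨁ (λ S → a S ∧ monomial S v) ∧ g v)
    ≡⟨ ⨁.∑-cong (λ v → ∧-distribʳ-⨁ (g v) (λ S → a S ∧ monomial S v)) ⟩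
  ⨁ (λ v → ⨁ (λ S → (a S ∧ monomial S v) ∧ g v))
    ≡⟨ ⨁.∑-swap (λ v S → (a S ∧ monomial S v) ∧ g v) ⟩
  ⨁ (λ S → ⨁ (λ v → (a S ∧ monomial S v) ∧ g v))
    ≡⟨ ⨁.∑-cong factor ⟩
  ⨁ (λ S → a S ∧ ⨁ (λ v → monomial S v ∧ g v)) ∎
  where
  open ≡-Reasoning
  factor : ∀ S → ⨁ (λ v → (a S ∧ monomial S v) ∧ g v) ≡ a S ∧ ⨁ (λ v → monomial S v ∧ g v)
  factor S = trans (⨁.∑-cong (λ v → ∧-assoc (a S) (monomial S v) (g v)))
                   (sym (∧-distribˡ-⨁ (a S) (λ v → monomial S v ∧ g v)))

⨁-represented : ∀ {m} {a : F2^ m → Bool} {f : BoolFun m} → Represents a f → ⨁ f ≡ a ones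
⨁-represented {a = a} {f} represents = begin
  ⨁ f                                          ≡⟨ ⨁.∑-cong (λ v → sym (∧-identityʳ (f v))) ⟩
  ⨁ (λ v → f v ∧ true)                         ≡⟨ ⨁-∧-represented represents (λ _ → true) ⟩
  ⨁ (λ S → a S ∧ ⨁ (λ v → monomial S v ∧ true)) ≡⟨ ⨁.∑-cong (λ S → cong (a S ∧_) (sum-monomial S)) ⟩
  ⨁ (λ S → a S ∧ monomial ones S)              ≡⟨ ⨁-select-ones a ⟩
  a ones                                       ∎
  where
  open ≡-Reasoning
  sum-monomial : ∀ S → ⨁ (λ v → monomial S v ∧ true) ≡ monomial ones S
  sum-monomial S = trans (⨁.∑-cong (∧-identityʳ ∘ monomial S)) (⨁-monomial S)

⨁-∧-complement : ∀ {m} (p q : F2^ m → Bool) →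
  ⨁ (λ y → p y ∧ q y) xor ⨁ (λ y → p y ∧ not (q y)) ≡ ⨁ p
⨁-∧-complement p q = trans (sym (⨁.∑-∙ (λ y → p y ∧ q y) (λ y → p y ∧ not (q y)))) (⨁.∑-cong split)
  where
  split : ∀ y → (p y ∧ q y) xor (p y ∧ not (q y)) ≡ p y
  split y = trans (sym (∧-distribˡ-xor (p y) (q y) (not (q y))))
                  (trans (cong (p y ∧_) (xor-inverseʳ (q y))) (∧-identityʳ (p y)))

-- x^S · ℓ has degree at most wt S + 1 < m, and a function of degree < m has even weight.
⨁-monomial-affine : ∀ {m} (S : F2^ m) → 2 + wt S ≤ m → ∀ c b →
  ⨁ (λ v → monomial S v ∧ (c xor (b · v))) ≡ false
⨁-monomial-affine {suc m} (true ∷ S) wt≤ c (b₀ ∷ b) = begin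
  ⨁ (λ v → monomial (true ∷ S) v ∧ ℓ v)
    ≡⟨ ⨁.∑-split (λ v → monomial (true ∷ S) v ∧ ℓ v) ⟩
  ⨁ {m} (λ _ → false) xor ⨁ (λ y → monomial S y ∧ ℓ (true ∷ y))
    ≡⟨ cong₂ _xor_ (⨁.∑-ε {m}) (⨁.∑-cong shift) ⟩
  ⨁ (λ y → monomial S y ∧ (c′ xor (b · y)))
    ≡⟨ ⨁-monomial-affine S (s≤s⁻¹ wt≤) c′ b ⟩
  false ∎
  where
  open ≡-Reasoning
  ℓ : F2^ (suc m) → Bool
  ℓ v = c xor ((b₀ ∷ b) · v)
  c′ : Bool
  c′ = c xor (b₀ ∧ true)
  shift : ∀ y → monomial S y ∧ ℓ (true ∷ y) ≡ monomial S y ∧ (c′ xor (b · y))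
  shift y = cong (monomial S y ∧_) (sym (xor-assoc c (b₀ ∧ true) (b · y)))
⨁-monomial-affine {suc m} (false ∷ S) wt≤ c (false ∷ b) =
  trans (⨁.∑-split (λ v → monomial (false ∷ S) v ∧ (c xor ((false ∷ b) · v))))
        (xor-same (⨁ (λ y → monomial S y ∧ (c xor (b · y)))))
⨁-monomial-affine {suc m} (false ∷ S) wt≤ c (true ∷ b) = begin
  ⨁ (λ v → monomial (false ∷ S) v ∧ (c xor ((true ∷ b) · v)))
    ≡⟨ ⨁.∑-split (λ v → monomial (false ∷ S) v ∧ (c xor ((true ∷ b) · v))) ⟩
  A xor ⨁ (λ y → monomial S y ∧ (c xor not (b · y)))
    ≡⟨ cong (A xor_) (⨁.∑-cong flip) ⟩
  A xor ⨁ (λ y → monomial S y ∧ not (ℓ y))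
    ≡⟨ ⨁-∧-complement (monomial S) ℓ ⟩
  ⨁ (monomial S)
    ≡⟨ ⨁-monomial S ⟩
  monomial ones S
    ≡⟨ monomial-ones S (s≤s⁻¹ wt≤) ⟩
  false ∎
  where
  open ≡-Reasoning
  ℓ : F2^ m → Bool
  ℓ y = c xor (b · y)
  A : Bool
  A = ⨁ (λ y → monomial S y ∧ ℓ y)
  flip : ∀ y → monomial S y ∧ (c xor not (b · y)) ≡ monomial S y ∧ not (ℓ y)
  flip y = cong (monomial S y ∧_) (sym (not-distribʳ-xor c (b · y)))

∈⇒≤-foldr-⊔ : ∀ {n xs} → n ∈ xs → n ≤ foldr _⊔_ 0 xs
∈⇒≤-foldr-⊔ {xs = xs} n∈xs =
  foldr-preservesᵒ (λ x y → [ m≤n⇒m≤n⊔o y , m≤n⇒m≤o⊔n x ]) 0 xs (inj₂ (Any-map ≤-reflexive n∈xs))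

-- The terms of anfDeg are local to its where-block; `terms` names them so that `with` can see `a S`.
anfDeg-unfold : ∀ {m} (a : F2^ m → Bool) →
  anfDeg a ≡ foldr _⊔_ 0 (map (λ S → if a S then wt S else 0) (allVecs m))
anfDeg-unfold {m} a = cong (foldr _⊔_ 0) (map-cong term (allVecs m))
  where
  terms : ∃ λ (t : F2^ m → ℕ) → anfDeg a ≡ foldr _⊔_ 0 (map t (allVecs m))
  terms = _ , refl
  term : ∀ S → proj₁ terms S ≡ (if a S then wt S else 0)
  term S with a S
  ... | true = refl
  ... | false = refl

anfDeg-≤ : ∀ {m} {a : F2^ m → Bool} {d} → (∀ S → a S ≡ true → wt S ≤ d) → anfDeg a ≤ d
anfDeg-≤ {m} {a} {d} bound =
  subst (_≤ d) (sym (anfDeg-unfold a))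
    (foldr-preservesᵇ {P = _≤ d} ⊔-lub z≤n (All-map⁺ (universal term≤ (allVecs m))))
  where
  term≤ : ∀ S → (if a S then wt S else 0) ≤ d
  term≤ S with a S in aS
  ... | true = bound S aS
  ... | false = z≤n

wt≤anfDeg : ∀ {m} {a : F2^ m → Bool} S → a S ≡ true → wt S ≤ anfDeg a
wt≤anfDeg {m} {a} S aS = subst (wt S ≤_) (sym (anfDeg-unfold a))
  (∈⇒≤-foldr-⊔ (subst (_∈ _) (cong (if_then wt S else 0) aS)
    (∈-map⁺ (λ S → if a S then wt S else 0) (∈-allVecs S))))

anfDeg-attained : ∀ {m} (a : F2^ m → Bool) {d} → anfDeg a ≡ suc d → ∃ λ S → a S ≡ true × wt S ≡ suc d
anfDeg-attained {m} a {d} deg≡ with foldr-selective ⊔-sel 0 (map (λ S → if a S then wt S else 0) (allVecs m))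
... | inj₁ max≡0 = contradiction (trans (sym deg≡) (trans (anfDeg-unfold a) max≡0)) λ ()
... | inj₂ max∈ with ∈-map⁻ (λ S → if a S then wt S else 0) max∈
...   | S , _ , max≡term = S , attained (a S) (trans (sym deg≡) (trans (anfDeg-unfold a) max≡term))
  where
  attained : ∀ c → suc d ≡ (if c then wt S else 0) → c ≡ true × wt S ≡ suc d
  attained true eq = refl , sym eq

anfDeg≡dim⇒top : ∀ {m} (a : F2^ (suc m) → Bool) → anfDeg a ≡ suc m → a ones ≡ true
anfDeg≡dim⇒top a deg≡ with anfDeg-attained a deg≡
... | S , a-S , wt-S = subst (λ S → a S ≡ true) (wt≡⇒≡ones S wt-S) a-S

-- Counting functions of APN functions

Δ : ∀ {m} → VecFun m → F2^ m → VecFun m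
Δ F u x = F (x ⊕ u) ⊕ F x

Δ-invariant : ∀ {m} (F : VecFun m) u x → Δ F u (x ⊕ u) ≡ Δ F u x
Δ-invariant F u x = trans (cong (λ y → F y ⊕ F (x ⊕ u)) (⊕-cancelʳ x u)) (⊕-comm (F x) (F (x ⊕ u)))

N≡∑ : ∀ {m} (F : VecFun m) u v → N F u v ≡ ∑ (λ x → ⟦ does (Δ F u x ≟ᵥ v) ⟧)
N≡∑ {m} F u v = length-filter (λ x → Δ F u x ≟ᵥ v) (allVecs m)

∑-δ : ∀ {m} (w : F2^ m) (c : F2^ m → ℕ) → ∑ (λ v → ⟦ does (w ≟ᵥ v) ⟧ * c v) ≡ c w
∑-δ [] c = trans (+-identityʳ _) (+-identityʳ (c []))
∑-δ {suc m} (false ∷ w) c = trans (∑.∑-split (λ v → ⟦ does ((false ∷ w) ≟ᵥ v) ⟧ * c v))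
  (trans (cong₂ _+_ (∑-δ w (c ∘ (false ∷_))) (∑.∑-ε {m})) (+-identityʳ _))
∑-δ {suc m} (true ∷ w) c = trans (∑.∑-split (λ v → ⟦ does ((true ∷ w) ≟ᵥ v) ⟧ * c v))
  (cong₂ _+_ (∑.∑-ε {m}) (∑-δ w (c ∘ (true ∷_))))

∑-N : ∀ {m} (F : VecFun m) u (c : F2^ m → ℕ) → ∑ (λ v → N F u v * c v) ≡ ∑ (λ x → c (Δ F u x))
∑-N F u c = begin
  ∑ (λ v → N F u v * c v)          ≡⟨ ∑.∑-cong (λ v → trans (cong (_* c v) (N≡∑ F u v)) (*-distribʳ-∑ (c v) (δ v))) ⟩
  ∑ (λ v → ∑ (λ x → δ v x * c v)) ≡⟨ ∑.∑-swap (λ v x → δ v x * c v) ⟩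
  ∑ (λ x → ∑ (λ v → δ v x * c v)) ≡⟨ ∑.∑-cong (λ x → ∑-δ (Δ F u x) c) ⟩
  ∑ (λ x → c (Δ F u x))            ∎
  where
  open ≡-Reasoning
  δ : F2^ _ → F2^ _ → ℕ
  δ v x = ⟦ does (Δ F u x ≟ᵥ v) ⟧

N≡2*countingFun : ∀ {m} {F : VecFun m} → IsAPN F → ∀ {u} → u ≢ zeroV →
  ∀ v → N F u v ≡ 2 * ⟦ countingFun F u v ⟧
N≡2*countingFun {F = F} apn {u} u≢0 v =
  subst (λ n → n ≡ 2 * ⟦ does (n ≟ℕ 2) ⟧) (sym N≡2k) (double≤2 k (subst (_≤ 2) N≡2k (apn u v u≢0)))
  where
  g : F2^ _ → ℕ
  g x = ⟦ does (Δ F u x ≟ᵥ v) ⟧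
  k : ℕ
  k = ∑.sumOver g (transversal u)
  N≡2k : N F u v ≡ 2 * k
  N≡2k = trans (N≡∑ F u v) (∑-invariant u≢0 g (cong (λ w → ⟦ does (w ≟ᵥ v) ⟧) ∘ Δ-invariant F u))
  double≤2 : ∀ k → 2 * k ≤ 2 → 2 * k ≡ 2 * ⟦ does (2 * k ≟ℕ 2) ⟧
  double≤2 0 _ = refl
  double≤2 1 _ = refl
  double≤2 (suc (suc k)) (s≤s (s≤s k+2+k≤0)) = contradiction (n≤0⇒n≡0 k+2+k≤0) (m+1+n≢0 k)

∑-countingFun : ∀ {m} {F : VecFun m} → IsAPN F → ∀ {u} → u ≢ zeroV → (h : F2^ m → Bool) →
  ∑ (λ x → ⟦ h (Δ F u x) ⟧) ≡ 2 * ∑ (λ v → ⟦ countingFun F u v ∧ h v ⟧)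
∑-countingFun {F = F} apn {u} u≢0 h = begin
  ∑ (λ x → ⟦ h (Δ F u x) ⟧)                  ≡⟨ sym (∑-N F u (⟦_⟧ ∘ h)) ⟩
  ∑ (λ v → N F u v * ⟦ h v ⟧)                ≡⟨ ∑.∑-cong halve ⟩
  ∑ (λ v → 2 * ⟦ countingFun F u v ∧ h v ⟧)  ≡⟨ sym (*-distribˡ-∑ 2 (λ v → ⟦ countingFun F u v ∧ h v ⟧)) ⟩
  2 * ∑ (λ v → ⟦ countingFun F u v ∧ h v ⟧)  ∎
  where
  open ≡-Reasoning
  halve : ∀ v → N F u v * ⟦ h v ⟧ ≡ 2 * ⟦ countingFun F u v ∧ h v ⟧
  halve v = begin
    N F u v * ⟦ h v ⟧                         ≡⟨ cong (_* ⟦ h v ⟧) (N≡2*countingFun apn u≢0 v) ⟩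
    2 * ⟦ countingFun F u v ⟧ * ⟦ h v ⟧       ≡⟨ *-assoc 2 ⟦ countingFun F u v ⟧ ⟦ h v ⟧ ⟩
    2 * (⟦ countingFun F u v ⟧ * ⟦ h v ⟧)     ≡⟨ cong (2 *_) (sym (⟦⟧-∧ (countingFun F u v) (h v))) ⟩
    2 * ⟦ countingFun F u v ∧ h v ⟧           ∎

⨁-countingFun-∧ : ∀ {m} {F : VecFun m} → IsAPN F → ∀ {u} → u ≢ zeroV → (h : F2^ m → Bool) (k : ℕ) →
  ∑ (λ x → ⟦ h (Δ F u x) ⟧) ≡ 2 * k → ⨁ (λ v → countingFun F u v ∧ h v) ≡ odd k
⨁-countingFun-∧ {F = F} apn {u} u≢0 h k sum≡2k =
  trans (sym (odd-∑ (λ v → countingFun F u v ∧ h v))) (cong odd (*-cancelˡ-≡ half k 2 twice≡2k))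
  where
  half : ℕ
  half = ∑ (λ v → ⟦ countingFun F u v ∧ h v ⟧)
  twice≡2k : 2 * half ≡ 2 * k
  twice≡2k = trans (sym (∑-countingFun apn u≢0 h)) sum≡2k

⨁-countingFun≡false : ∀ {m} {F : VecFun (2 + m)} → IsAPN F → ∀ {u} → u ≢ zeroV →
  ⨁ (countingFun F u) ≡ false
⨁-countingFun≡false {m} {F} apn {u} u≢0 = begin
  ⨁ (countingFun F u)                 ≡⟨ ⨁.∑-cong (λ v → sym (∧-identityʳ (countingFun F u v))) ⟩
  ⨁ (λ v → countingFun F u v ∧ true)  ≡⟨ ⨁-countingFun-∧ apn u≢0 (λ _ → true) (2 ^ suc m) (∑-one {2 + m}) ⟩
  odd (2 ^ suc m)                     ≡⟨ odd-2* (2 ^ m) ⟩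
  false                               ∎
  where open ≡-Reasoning

⨁-countingFun-linear : ∀ {m} {F : VecFun m} → IsAPN F → ∀ {u} → u ≢ zeroV → ∀ b →
  ⨁ (λ v → countingFun F u v ∧ (b · v)) ≡ ⨁ (component b F)
⨁-countingFun-linear {F = F} apn {u} u≢0 b with ∑-derivative u≢0 (component b F)
... | k , sum≡2k , odd-k = trans (⨁-countingFun-∧ apn u≢0 (b ·_) k (trans linearity sum≡2k)) odd-k
  where
  linearity : ∑ (λ x → ⟦ b · Δ F u x ⟧) ≡ ∑ (λ x → ⟦ (b · F (x ⊕ u)) xor (b · F x) ⟧)
  linearity = ∑.∑-cong (λ x → cong ⟦_⟧ (·-distribˡ-⊕ b (F (x ⊕ u)) (F x)))

countingFun-hasAlgDeg : ∀ {m} (F : VecFun (2 + m)) → IsAPN F → HasAlgDegV F (2 + m) →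
  ∀ u → u ≢ zeroV → HasAlgDeg (countingFun F u) (1 + m)
countingFun-hasAlgDeg {m} F apn (_ , b , a , a-represents , deg-a) u u≢0 =
  c , anf-represents n , ≤-antisym (anfDeg-≤ below-top) (≤-trans (high S₀ Q-S₀) (wt≤anfDeg S₀ c-S₀))
  where
  open ≡-Reasoning
  n : BoolFun (2 + m)
  n = countingFun F u
  c : F2^ (2 + m) → Bool
  c = anf n
  Q : F2^ (2 + m) → Bool
  Q S = ⨁ (λ v → monomial S v ∧ (b · v))

  below-top : ∀ S → c S ≡ true → wt S ≤ 1 + m
  below-top S c-S = ≤-pred (≤∧≢⇒< (wt≤ S) (λ full → contradiction (trans (sym c-S) (c-at full)) λ ()))
    where
    c-at : wt S ≡ 2 + m → c S ≡ false
    c-at full = trans (cong c (wt≡⇒≡ones S full))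
                      (trans (sym (⨁-represented (anf-represents n))) (⨁-countingFun≡false apn u≢0))

  high : ∀ S → Q S ≡ true → 1 + m ≤ wt S
  high S Q-S with wt S ≤? m
  ... | yes wt≤m = contradiction (trans (sym Q-S) (⨁-monomial-affine S (s≤s (s≤s wt≤m)) false b)) λ ()
  ... | no wt≰m = ≰⇒> wt≰m

  pairing : ⨁ (λ S → c S ∧ Q S) ≡ true
  pairing = begin
    ⨁ (λ S → c S ∧ Q S)        ≡⟨ sym (⨁-∧-represented (anf-represents n) (b ·_)) ⟩
    ⨁ (λ v → n v ∧ (b · v))    ≡⟨ ⨁-countingFun-linear apn u≢0 b ⟩
    ⨁ (component b F)          ≡⟨ ⨁-represented a-represents ⟩
    a ones                     ≡⟨ anfDeg≡dim⇒top a deg-a ⟩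
    true                       ∎

  witness : ∃ λ S → c S ≡ true × Q S ≡ true
  witness = ⨁-∧≡true⇒∃ c Q (allVecs (2 + m)) pairing
  S₀ : F2^ (2 + m)
  S₀ = proj₁ witness
  c-S₀ : c S₀ ≡ true
  c-S₀ = proj₁ (proj₂ witness)
  Q-S₀ : Q S₀ ≡ true
  Q-S₀ = proj₂ (proj₂ witness)

mainTheorem7 : (F : VecFun 6) → IsAPN F → HasAlgDegV F 6 →
    (u : F2^ 6) → ¬ (u ≡ zeroV) → HasAlgDeg (countingFun F u) 5
mainTheorem7 = countingFun-hasAlgDeg
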